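{- For $k\ge1$, $$Q_{132}^{(k,0,0,0)}(t,x)|_x=Q_{132}^{(k-1,0,0,0)}(t,x)|_x\cdot\frac{t\frac{d}{dt}Q_{132}^{(k,0,0,0)}(t,0)}{\frac{d}{dt}\left(t\,Q_{132}^{(k-1,0,0,0)}(t,0)\right)}.$$
   Context: For $\sigma=\sigma_1\cdots\sigma_n\in S_n$ and $m\in\mathbb{N}$, $\mathrm{mmp}^{(m,0,0,0)}(\sigma)$ is the number of positions $i$ such that there are at least $m$ indices $j>i$ with $\sigma_j>\sigma_i$ (so $\mathrm{mmp}^{(0,0,0,0)}(\sigma)=n$). $S_n(132)$ is the set of 132-avoiding permutations of $[n]$. $Q_{n,132}^{(m,0,0,0)}(x)=\sum_{\sigma\in S_n(132)}x^{\mathrm{mmp}^{(m,0,0,0)}(\sigma)}$, and $Q_{132}^{(m,0,0,0)}(t,x)=1+\sum_{n\ge1}t^nQ_{n,132}^{(m,0,0,0)}(x)$, a formal power series in $t$. $F(t,x)|_x$ denotes the coefficient of $x^1$ in $F$, i.e. the power series $\sum_n t^n\,(\text{coefficient of }x\text{ in }Q_{n,132}^{(m,0,0,0)}(x))$; $Q_{132}^{(m,0,0,0)}(t,0)$ is the series of constant terms. -}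

module Defs where

open import Data.Nat using (ℕ; zero; suc; _+_; _*_; _∸_; _<ᵇ_; _≤ᵇ_; _≡ᵇ_)
open import Data.Bool using (Bool; true; false; _∧_; _∨_; not; if_then_else_)
open import Data.List using (List; []; _∷_; [_]; map; concatMap; filter; length; upTo)
open import Data.Bool.ListAction using (any)
open import Data.Nat.ListAction using (sum)
open import Relation.Nullary.Decidable using (does)
open import Data.Bool.Properties using (T?)

-- A permutation of [n] is represented as the list σ₁ ⋯ σₙ of its values in 1..n.

insertions : ℕ → List ℕ → List (List ℕ)
insertions x [] = [ x ∷ [] ]
insertions x (y ∷ ys) = (x ∷ y ∷ ys) ∷ map (y ∷_) (insertions x ys)

perms : ℕ → List (List ℕ)
perms zero = [ [] ]
perms (suc n) = concatMap (insertions (suc n)) (perms n)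

has21above : ℕ → List ℕ → Bool
has21above a [] = false
has21above a (b ∷ rest) = any (λ c → (a <ᵇ c) ∧ (c <ᵇ b)) rest ∨ has21above a rest

has132 : List ℕ → Bool
has132 [] = false
has132 (a ∷ rest) = has21above a rest ∨ has132 rest

-- mmp^(m,0,0,0)(σ): number of positions i with at least m later entries larger than σ_i
mmp : ℕ → List ℕ → ℕ
mmp m [] = 0
mmp m (a ∷ rest) =
  (if m ≤ᵇ length (filter (λ c → T? (a <ᵇ c)) rest) then 1 else 0) + mmp m rest

-- coefficient of t^n x^j in Q_132^(m,0,0,0)(t,x)
-- (n = 0: the empty permutation, giving the constant term 1)
Qcoef : ℕ → ℕ → ℕ → ℕ
Qcoef m n j =
  length (filter (λ σ → T? (not (has132 σ) ∧ (mmp m σ ≡ᵇ j))) (perms n))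

-- formal power series in t with natural-number coefficients
Series : Set
Series = ℕ → ℕ

Qx : ℕ → Series
Qx m n = Qcoef m n 1

Q0 : ℕ → Series
Q0 m n = Qcoef m n 0

_*ₛ_ : Series → Series → Series
(f *ₛ g) n = sum (map (λ i → f i * g (n ∸ i)) (upTo (suc n)))

deriv : Series → Series
deriv f n = suc n * f (suc n)

tmul : Series → Series
tmul f zero = 0
tmul f (suc n) = f n

-- Theorem 10: for k ≥ 1,
--   Q^(k)(t,x)|_x · d/dt (t Q^(k-1)(t,0)) = Q^(k-1)(t,x)|_x · t d/dt Q^(k)(t,0),
-- stated with k+1 in place of k and without division.
--
-- Write a = Q^(k)(t,0), A = Q^(k+1)(t,0), b = Q^(k)(t,x)|_x, B = Q^(k+1)(t,x)|_x.
--
-- Every permutation of [n+1] is obtained from one τ of [n] by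
-- inserting the maximum n+1 at a position q; the result σ = α (n+1) β avoids 132
-- exactly when α and β do and every entry of α exceeds every entry of β.  In that
-- case each entry of α gains exactly one larger later entry, so
--   mmp^(k+1)(σ) = mmp^(k)(α) + mmp^(k+1)(β),
-- and α (standardised) and β range independently over S_q(132) and S_{n-q}(132).
-- Hence Q^(k+1)(t,x) = 1 + t Q^(k)(t,x) Q^(k+1)(t,x); comparing the coefficients of
-- x^0 and x^1 gives
--   A = 1 + t a A,            B = t (b A + a B).
--
-- A solution X of X = U + t V X is unique, and equals U·A when
-- A = 1 + t V A.  Hence B = t b A², and applying θ = t d/dt to A = 1 + t a A gives
-- θA = θ(t a) A².  So B · θ(t a) = t b θA; cancelling a factor t gives the theorem.

module Submission where

open import Defs
open import Data.Nat using (ℕ; zero; suc; _+_; _*_; _∸_; _≤_; _<_; z≤n; s≤s; _<ᵇ_; _≤ᵇ_; _≡ᵇ_)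
open import Data.Nat.Properties
open import Algebra.Properties.CommutativeSemigroup +-commutativeSemigroup using (interchange)
open import Algebra.Properties.CommutativeSemigroup *-commutativeSemigroup
  using () renaming (x∙yz≈y∙xz to *-left-comm)
open import Data.Nat.Induction using (<-rec)
open import Data.Bool using (Bool; true; false; _∧_; _∨_; not; if_then_else_)
open import Data.Bool.Properties
  using (∨-assoc; ∨-comm; ∨-identityʳ; ∨-zeroʳ; ∨-conicalˡ; ∨-conicalʳ; ∧-identityʳ; ∧-zeroʳ; ∨-commutativeMonoid; T?)
open import Algebra.Bundles using (CommutativeMonoid)
open import Algebra.Properties.CommutativeSemigroup (CommutativeMonoid.commutativeSemigroup ∨-commutativeMonoid)
  using () renaming (x∙yz≈y∙xz to ∨-left-comm; interchange to ∨-interchange)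
open import Data.Bool.ListAction using (any; or)
open import Data.Nat.ListAction using (sum)
open import Data.Nat.ListAction.Properties using (sum-++)
open import Data.List using (List; []; _∷_; map; applyUpTo; upTo; length; take; drop; _++_; filter; concatMap)
open import Data.List.Properties using (map-cong; map-∘; map-++; take++drop≡id)
open import Data.List.Relation.Unary.All using (All; []; _∷_)
import Data.List.Relation.Unary.All as All
open import Data.List.Relation.Unary.All.Properties using (map⁺; concat⁺; take⁺; drop⁺)
open import Data.Product using (_×_; _,_)
open import Data.Sum using (inj₁; inj₂)
open import Relation.Binary.PropositionalEquality

-- ∑[ i < k ] f i = f 0 + ⋯ + f (k ∸ 1).  Peeling off the first term makes
-- reindexing by suc definitional.
∑< : ℕ → (ℕ → ℕ) → ℕ
∑< zero    f = 0
∑< (suc k) f = f 0 + ∑< k (λ i → f (suc i))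

syntax ∑< k (λ i → e) = ∑[ i < k ] e

module FiniteSums where
  open ≡-Reasoning

  sum-applyUpTo : ∀ k (h g : ℕ → ℕ) → sum (map h (applyUpTo g k)) ≡ ∑[ i < k ] h (g i)
  sum-applyUpTo zero    h g = refl
  sum-applyUpTo (suc k) h g = cong (h (g 0) +_) (sum-applyUpTo k h (λ i → g (suc i)))

  ∑-cong< : ∀ k {f g : ℕ → ℕ} → (∀ i → i < k → f i ≡ g i) → ∑< k f ≡ ∑< k g
  ∑-cong< zero    f≡g = refl
  ∑-cong< (suc k) f≡g = cong₂ _+_ (f≡g 0 (s≤s z≤n)) (∑-cong< k (λ i i<k → f≡g (suc i) (s≤s i<k)))

  ∑-cong : ∀ k {f g : ℕ → ℕ} → f ≗ g → ∑< k f ≡ ∑< k g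
  ∑-cong k f≗g = ∑-cong< k (λ i _ → f≗g i)

  ∑-zero : ∀ k → ∑[ i < k ] 0 ≡ 0
  ∑-zero zero    = refl
  ∑-zero (suc k) = ∑-zero k

  ∑-snoc : ∀ k f → ∑< (suc k) f ≡ ∑< k f + f k
  ∑-snoc zero    f = +-comm (f 0) 0
  ∑-snoc (suc k) f = begin
    f 0 + ∑< (suc k) (λ i → f (suc i))        ≡⟨ cong (f 0 +_) (∑-snoc k (λ i → f (suc i))) ⟩
    f 0 + (∑< k (λ i → f (suc i)) + f (suc k)) ≡⟨ +-assoc (f 0) _ _ ⟨
    f 0 + ∑< k (λ i → f (suc i)) + f (suc k)   ∎

  ∑-+ : ∀ k f g → ∑[ i < k ] (f i + g i) ≡ ∑< k f + ∑< k g
  ∑-+ zero    f g = refl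
  ∑-+ (suc k) f g = begin
    f 0 + g 0 + ∑[ i < k ] (f (suc i) + g (suc i))
      ≡⟨ cong (f 0 + g 0 +_) (∑-+ k (λ i → f (suc i)) (λ i → g (suc i))) ⟩
    f 0 + g 0 + (∑[ i < k ] f (suc i) + ∑[ i < k ] g (suc i))
      ≡⟨ interchange (f 0) (g 0) _ _ ⟩
    f 0 + ∑[ i < k ] f (suc i) + (g 0 + ∑[ i < k ] g (suc i)) ∎

  ∑-*ˡ : ∀ k c f → ∑[ i < k ] (c * f i) ≡ c * ∑< k f
  ∑-*ˡ zero    c f = sym (*-zeroʳ c)
  ∑-*ˡ (suc k) c f = trans (cong (c * f 0 +_) (∑-*ˡ k c (λ i → f (suc i))))
                           (sym (*-distribˡ-+ c (f 0) _))

  ∑-*ʳ : ∀ k c f → ∑[ i < k ] (f i * c) ≡ ∑< k f * c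
  ∑-*ʳ k c f = trans (∑-cong k (λ i → *-comm (f i) c)) (trans (∑-*ˡ k c f) (*-comm c _))

  ∑-reverse : ∀ n f → ∑< (suc n) f ≡ ∑[ i < suc n ] f (n ∸ i)
  ∑-reverse zero    f = refl
  ∑-reverse (suc n) f = begin
    ∑< (suc (suc n)) f                       ≡⟨ ∑-snoc (suc n) f ⟩
    ∑< (suc n) f + f (suc n)                 ≡⟨ cong (_+ f (suc n)) (∑-reverse n f) ⟩
    ∑[ i < suc n ] f (n ∸ i) + f (suc n)     ≡⟨ +-comm _ (f (suc n)) ⟩
    f (suc n) + ∑[ i < suc n ] f (n ∸ i)     ∎

  ∑-truncate : ∀ k p h → p ≤ k → (∀ q → p ≤ q → q < k → h q ≡ 0) → ∑< k h ≡ ∑< p h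
  ∑-truncate zero    .zero h z≤n  _      = refl
  ∑-truncate (suc k) p     h p≤1+k vanish with m≤n⇒m<n∨m≡n p≤1+k
  ... | inj₂ refl      = refl
  ... | inj₁ (s≤s p≤k) = begin
    ∑< (suc k) h ≡⟨ ∑-snoc k h ⟩
    ∑< k h + h k ≡⟨ cong₂ _+_ (∑-truncate k p h p≤k (λ q p≤q q<k → vanish q p≤q (m≤n⇒m≤1+n q<k)))
                              (vanish k p≤k ≤-refl) ⟩
    ∑< p h + 0   ≡⟨ +-identityʳ _ ⟩
    ∑< p h       ∎

  ∑-triangle : ∀ n (F : ℕ → ℕ → ℕ) →
    ∑[ i < n ] ∑[ j < suc i ] F i j ≡ ∑[ j < n ] ∑[ l < n ∸ j ] F (j + l) j
  ∑-triangle zero    F = refl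
  ∑-triangle (suc m) F = begin
    F 0 0 + 0 + ∑[ i < m ] (F (suc i) 0 + ∑[ j < suc i ] F (suc i) (suc j))
      ≡⟨ cong₂ _+_ (+-identityʳ (F 0 0)) (∑-+ m _ _) ⟩
    F 0 0 + (∑[ i < m ] F (suc i) 0 + ∑[ i < m ] ∑[ j < suc i ] F (suc i) (suc j))
      ≡⟨ cong (λ s → F 0 0 + (∑[ i < m ] F (suc i) 0 + s)) (∑-triangle m (λ i j → F (suc i) (suc j))) ⟩
    F 0 0 + (∑[ l < m ] F (suc l) 0 + ∑[ j < m ] ∑[ l < m ∸ j ] F (suc (j + l)) (suc j))
      ≡⟨ +-assoc (F 0 0) _ _ ⟨
    F 0 0 + ∑[ l < m ] F (suc l) 0 + ∑[ j < m ] ∑[ l < m ∸ j ] F (suc (j + l)) (suc j) ∎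

open FiniteSums

one : Series
one zero    = 1
one (suc _) = 0

infixl 6 _+ₛ_
_+ₛ_ : Series → Series → Series
(f +ₛ g) n = f n + g n

θ : Series → Series
θ f n = n * f n

module PowerSeries where
  open ≡-Reasoning

  *ₛ-coeff : ∀ f g n → (f *ₛ g) n ≡ ∑[ i < suc n ] (f i * g (n ∸ i))
  *ₛ-coeff f g n = sum-applyUpTo (suc n) (λ i → f i * g (n ∸ i)) (λ i → i)

  *ₛ-cong : ∀ {f f′ g g′} → f ≗ f′ → g ≗ g′ → f *ₛ g ≗ f′ *ₛ g′
  *ₛ-cong f≗f′ g≗g′ n = cong sum (map-cong (λ i → cong₂ _*_ (f≗f′ i) (g≗g′ (n ∸ i))) (upTo (suc n)))

  *ₛ-congˡ : ∀ {f g g′} → g ≗ g′ → f *ₛ g ≗ f *ₛ g′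
  *ₛ-congˡ {f} = *ₛ-cong {f} {f} (λ _ → refl)

  *ₛ-congʳ : ∀ {f f′ g} → f ≗ f′ → f *ₛ g ≗ f′ *ₛ g
  *ₛ-congʳ {g = g} f≗f′ = *ₛ-cong {g = g} {g′ = g} f≗f′ (λ _ → refl)

  +ₛ-cong : ∀ {f f′ g g′} → f ≗ f′ → g ≗ g′ → f +ₛ g ≗ f′ +ₛ g′
  +ₛ-cong f≗f′ g≗g′ n = cong₂ _+_ (f≗f′ n) (g≗g′ n)

  *ₛ-comm : ∀ f g → f *ₛ g ≗ g *ₛ f
  *ₛ-comm f g n = begin
    (f *ₛ g) n                                   ≡⟨ *ₛ-coeff f g n ⟩
    ∑[ i < suc n ] (f i * g (n ∸ i))             ≡⟨ ∑-reverse n (λ i → f i * g (n ∸ i)) ⟩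
    ∑[ i < suc n ] (f (n ∸ i) * g (n ∸ (n ∸ i))) ≡⟨ ∑-cong< (suc n) swap ⟩
    ∑[ i < suc n ] (g i * f (n ∸ i))             ≡⟨ *ₛ-coeff g f n ⟨
    (g *ₛ f) n                                   ∎
    where
    swap : ∀ i → i < suc n → f (n ∸ i) * g (n ∸ (n ∸ i)) ≡ g i * f (n ∸ i)
    swap i (s≤s i≤n) rewrite m∸[m∸n]≡n i≤n = *-comm (f (n ∸ i)) (g i)

  *ₛ-distribˡ : ∀ f g h → f *ₛ (g +ₛ h) ≗ f *ₛ g +ₛ f *ₛ h
  *ₛ-distribˡ f g h n = begin
    (f *ₛ (g +ₛ h)) n
      ≡⟨ *ₛ-coeff f (g +ₛ h) n ⟩
    ∑[ i < suc n ] (f i * (g (n ∸ i) + h (n ∸ i)))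
      ≡⟨ ∑-cong (suc n) (λ i → *-distribˡ-+ (f i) (g (n ∸ i)) (h (n ∸ i))) ⟩
    ∑[ i < suc n ] (f i * g (n ∸ i) + f i * h (n ∸ i))
      ≡⟨ ∑-+ (suc n) (λ i → f i * g (n ∸ i)) (λ i → f i * h (n ∸ i)) ⟩
    ∑[ i < suc n ] (f i * g (n ∸ i)) + ∑[ i < suc n ] (f i * h (n ∸ i))
      ≡⟨ cong₂ _+_ (*ₛ-coeff f g n) (*ₛ-coeff f h n) ⟨
    (f *ₛ g) n + (f *ₛ h) n ∎

  -- Associativity: both sides are the sum of f j g l h m over j + l + m = n;
  -- the left groups the terms by j + l, the right by j.
  *ₛ-assoc : ∀ f g h → (f *ₛ g) *ₛ h ≗ f *ₛ (g *ₛ h)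
  *ₛ-assoc f g h n = begin
    ((f *ₛ g) *ₛ h) n
      ≡⟨ *ₛ-coeff (f *ₛ g) h n ⟩
    ∑[ i < suc n ] ((f *ₛ g) i * h (n ∸ i))
      ≡⟨ ∑-cong (suc n) expand ⟩
    ∑[ i < suc n ] ∑[ j < suc i ] (f j * g (i ∸ j) * h (n ∸ i))
      ≡⟨ ∑-triangle (suc n) (λ i j → f j * g (i ∸ j) * h (n ∸ i)) ⟩
    ∑[ j < suc n ] ∑[ l < suc n ∸ j ] (f j * g (j + l ∸ j) * h (n ∸ (j + l)))
      ≡⟨ ∑-cong< (suc n) column ⟩
    ∑[ j < suc n ] (f j * (g *ₛ h) (n ∸ j))
      ≡⟨ *ₛ-coeff f (g *ₛ h) n ⟨
    (f *ₛ (g *ₛ h)) n ∎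
    where
    expand : ∀ i → (f *ₛ g) i * h (n ∸ i) ≡ ∑[ j < suc i ] (f j * g (i ∸ j) * h (n ∸ i))
    expand i = trans (cong (_* h (n ∸ i)) (*ₛ-coeff f g i))
                     (sym (∑-*ʳ (suc i) (h (n ∸ i)) (λ j → f j * g (i ∸ j))))

    regroup : ∀ j l → f j * g (j + l ∸ j) * h (n ∸ (j + l)) ≡ f j * (g l * h (n ∸ j ∸ l))
    regroup j l rewrite m+n∸m≡n j l | sym (∸-+-assoc n j l) = *-assoc (f j) (g l) _

    column : ∀ j → j < suc n →
      ∑[ l < suc n ∸ j ] (f j * g (j + l ∸ j) * h (n ∸ (j + l))) ≡ f j * (g *ₛ h) (n ∸ j)
    column j (s≤s j≤n) = begin
      ∑[ l < suc n ∸ j ] (f j * g (j + l ∸ j) * h (n ∸ (j + l)))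
        ≡⟨ cong (λ k → ∑[ l < k ] (f j * g (j + l ∸ j) * h (n ∸ (j + l)))) (+-∸-assoc 1 j≤n) ⟩
      ∑[ l < suc (n ∸ j) ] (f j * g (j + l ∸ j) * h (n ∸ (j + l)))
        ≡⟨ ∑-cong (suc (n ∸ j)) (regroup j) ⟩
      ∑[ l < suc (n ∸ j) ] (f j * (g l * h (n ∸ j ∸ l)))
        ≡⟨ ∑-*ˡ (suc (n ∸ j)) (f j) (λ l → g l * h (n ∸ j ∸ l)) ⟩
      f j * ∑[ l < suc (n ∸ j) ] (g l * h (n ∸ j ∸ l))
        ≡⟨ cong (f j *_) (*ₛ-coeff g h (n ∸ j)) ⟨
      f j * (g *ₛ h) (n ∸ j) ∎

  *ₛ-identityˡ : ∀ f → one *ₛ f ≗ f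
  *ₛ-identityˡ f n = begin
    (one *ₛ f) n           ≡⟨ *ₛ-coeff one f n ⟩
    f n + 0 + ∑[ i < n ] 0 ≡⟨ cong₂ _+_ (+-identityʳ (f n)) (∑-zero n) ⟩
    f n + 0                ≡⟨ +-identityʳ (f n) ⟩
    f n                    ∎

  *ₛ-identityʳ : ∀ f → f *ₛ one ≗ f
  *ₛ-identityʳ f n = trans (*ₛ-comm f one n) (*ₛ-identityˡ f n)

  *ₛ-left-comm : ∀ f g h → f *ₛ (g *ₛ h) ≗ g *ₛ (f *ₛ h)
  *ₛ-left-comm f g h n = begin
    (f *ₛ (g *ₛ h)) n ≡⟨ *ₛ-assoc f g h n ⟨
    ((f *ₛ g) *ₛ h) n ≡⟨ *ₛ-congʳ {g = h} (*ₛ-comm f g) n ⟩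
    ((g *ₛ f) *ₛ h) n ≡⟨ *ₛ-assoc g f h n ⟩
    (g *ₛ (f *ₛ h)) n ∎

  tmul-cong : ∀ {f g} → f ≗ g → tmul f ≗ tmul g
  tmul-cong f≗g zero    = refl
  tmul-cong f≗g (suc n) = f≗g n

  tmul-+ₛ : ∀ f g → tmul (f +ₛ g) ≗ tmul f +ₛ tmul g
  tmul-+ₛ f g zero    = refl
  tmul-+ₛ f g (suc n) = refl

  tmul-*ₛˡ : ∀ f g → tmul f *ₛ g ≗ tmul (f *ₛ g)
  tmul-*ₛˡ f g zero    = *ₛ-coeff (tmul f) g zero
  tmul-*ₛˡ f g (suc n) = trans (*ₛ-coeff (tmul f) g (suc n)) (sym (*ₛ-coeff f g n))

  tmul-*ₛʳ : ∀ f g → f *ₛ tmul g ≗ tmul (f *ₛ g)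
  tmul-*ₛʳ f g n = trans (*ₛ-comm f (tmul g) n) (trans (tmul-*ₛˡ g f n) (tmul-cong (*ₛ-comm g f) n))

  θ-deriv : ∀ f → θ f ≗ tmul (deriv f)
  θ-deriv f zero    = refl
  θ-deriv f (suc n) = refl

  θ-cong : ∀ {f g} → f ≗ g → θ f ≗ θ g
  θ-cong f≗g n = cong (n *_) (f≗g n)

  θ-one+ : ∀ f → θ (one +ₛ f) ≗ θ f
  θ-one+ f zero    = refl
  θ-one+ f (suc n) = refl

  -- Leibniz rule: the coefficient n of tⁿ in f g splits as i + (n ∸ i).
  θ-*ₛ : ∀ f g → θ (f *ₛ g) ≗ θ f *ₛ g +ₛ f *ₛ θ g
  θ-*ₛ f g n = begin
    n * (f *ₛ g) n
      ≡⟨ cong (n *_) (*ₛ-coeff f g n) ⟩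
    n * ∑[ i < suc n ] (f i * g (n ∸ i))
      ≡⟨ ∑-*ˡ (suc n) n (λ i → f i * g (n ∸ i)) ⟨
    ∑[ i < suc n ] (n * (f i * g (n ∸ i)))
      ≡⟨ ∑-cong< (suc n) (λ i i<1+n → split i (≤-pred i<1+n)) ⟩
    ∑[ i < suc n ] (θ f i * g (n ∸ i) + f i * θ g (n ∸ i))
      ≡⟨ ∑-+ (suc n) (λ i → θ f i * g (n ∸ i)) (λ i → f i * θ g (n ∸ i)) ⟩
    ∑[ i < suc n ] (θ f i * g (n ∸ i)) + ∑[ i < suc n ] (f i * θ g (n ∸ i))
      ≡⟨ cong₂ _+_ (*ₛ-coeff (θ f) g n) (*ₛ-coeff f (θ g) n) ⟨
    (θ f *ₛ g) n + (f *ₛ θ g) n ∎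
    where
    split : ∀ i → i ≤ n → n * (f i * g (n ∸ i)) ≡ θ f i * g (n ∸ i) + f i * θ g (n ∸ i)
    split i i≤n = begin
      n * (f i * g (n ∸ i))
        ≡⟨ cong (_* (f i * g (n ∸ i))) (m+[n∸m]≡n i≤n) ⟨
      (i + (n ∸ i)) * (f i * g (n ∸ i))
        ≡⟨ *-distribʳ-+ (f i * g (n ∸ i)) i (n ∸ i) ⟩
      i * (f i * g (n ∸ i)) + (n ∸ i) * (f i * g (n ∸ i))
        ≡⟨ cong₂ _+_ (*-assoc i (f i) (g (n ∸ i))) (*-left-comm (f i) (n ∸ i) (g (n ∸ i))) ⟨
      i * f i * g (n ∸ i) + f i * ((n ∸ i) * g (n ∸ i)) ∎

  -- Solutions of X = U + t V X are unique: the coefficient of tⁿ⁺¹ is determined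
  -- by the coefficients of X up to tⁿ.
  unique-solution : ∀ {U V X Y} → X ≗ U +ₛ tmul (V *ₛ X) → Y ≗ U +ₛ tmul (V *ₛ Y) → X ≗ Y
  unique-solution {U} {V} {X} {Y} X-eq Y-eq = <-rec (λ n → X n ≡ Y n) step
    where
    step : ∀ n → (∀ {m} → m < n → X m ≡ Y m) → X n ≡ Y n
    step zero    _       = trans (X-eq zero) (sym (Y-eq zero))
    step (suc n) earlier = begin
      X (suc n)              ≡⟨ X-eq (suc n) ⟩
      U (suc n) + (V *ₛ X) n ≡⟨ cong (U (suc n) +_) lower-terms ⟩
      U (suc n) + (V *ₛ Y) n ≡⟨ Y-eq (suc n) ⟨
      Y (suc n)              ∎
      where
      lower-terms : (V *ₛ X) n ≡ (V *ₛ Y) n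
      lower-terms = begin
        (V *ₛ X) n                       ≡⟨ *ₛ-coeff V X n ⟩
        ∑[ i < suc n ] (V i * X (n ∸ i)) ≡⟨ ∑-cong (suc n) (λ i → cong (V i *_) (earlier (s≤s (m∸n≤m n i)))) ⟩
        ∑[ i < suc n ] (V i * Y (n ∸ i)) ≡⟨ *ₛ-coeff V Y n ⟨
        (V *ₛ Y) n                       ∎

open PowerSeries

module LinearEquations where
  open import Relation.Binary.Reasoning.Setoid (ℕ →-setoid ℕ)

  -- If A = 1 + t V A, then U·A solves X = U + t V X, hence is its only solution.
  linear-solution : ∀ {U V A X} → A ≗ one +ₛ tmul (V *ₛ A) → X ≗ U +ₛ tmul (V *ₛ X) → X ≗ U *ₛ A
  linear-solution {U} {V} {A} {X} A-eq X-eq = unique-solution {U} {V} X-eq UA-eq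
    where
    UA-eq : U *ₛ A ≗ U +ₛ tmul (V *ₛ (U *ₛ A))
    UA-eq = begin
      U *ₛ A                         ≈⟨ *ₛ-congˡ {U} A-eq ⟩
      U *ₛ (one +ₛ tmul (V *ₛ A))    ≈⟨ *ₛ-distribˡ U one (tmul (V *ₛ A)) ⟩
      U *ₛ one +ₛ U *ₛ tmul (V *ₛ A) ≈⟨ +ₛ-cong (*ₛ-identityʳ U) (tmul-*ₛʳ U (V *ₛ A)) ⟩
      U +ₛ tmul (U *ₛ (V *ₛ A))      ≈⟨ +ₛ-cong {f = U} (λ _ → refl) (tmul-cong (*ₛ-left-comm U V A)) ⟩
      U +ₛ tmul (V *ₛ (U *ₛ A))      ∎

  -- From A = 1 + t a A and B = t (b A + a B):  B · d/dt (t a) = b · t A′.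
  -- Indeed B = t b A² and θA = θ(t a) A², so B · θ(t a) = t b θA.
  derivative-identity : ∀ {a b A B} → A ≗ one +ₛ tmul (a *ₛ A) → B ≗ tmul (b *ₛ A +ₛ a *ₛ B) →
    B *ₛ deriv (tmul a) ≗ b *ₛ tmul (deriv A)
  derivative-identity {a} {b} {A} {B} A-eq B-eq n = t-multiple (suc n)
    where
    B-closed : B ≗ tmul (b *ₛ A) *ₛ A
    B-closed = linear-solution {U = tmul (b *ₛ A)} {V = a} A-eq (λ m → trans (B-eq m) (tmul-+ₛ (b *ₛ A) (a *ₛ B) m))

    θA-eq : θ A ≗ A *ₛ θ (tmul a) +ₛ tmul (a *ₛ θ A)
    θA-eq = begin
      θ A                                           ≈⟨ θ-cong A-eq ⟩
      θ (one +ₛ tmul (a *ₛ A))                      ≈⟨ θ-one+ (tmul (a *ₛ A)) ⟩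
      θ (tmul (a *ₛ A))                             ≈⟨ θ-cong (tmul-*ₛˡ a A) ⟨
      θ (tmul a *ₛ A)                               ≈⟨ θ-*ₛ (tmul a) A ⟩
      θ (tmul a) *ₛ A +ₛ tmul a *ₛ θ A              ≈⟨ +ₛ-cong (*ₛ-comm (θ (tmul a)) A) (tmul-*ₛˡ a (θ A)) ⟩
      A *ₛ θ (tmul a) +ₛ tmul (a *ₛ θ A)            ∎

    θA-closed : θ A ≗ (A *ₛ θ (tmul a)) *ₛ A
    θA-closed = linear-solution {U = A *ₛ θ (tmul a)} {V = a} A-eq θA-eq

    t-multiple : tmul (B *ₛ deriv (tmul a)) ≗ tmul (b *ₛ tmul (deriv A))
    t-multiple = begin
      tmul (B *ₛ deriv (tmul a))                  ≈⟨ tmul-*ₛʳ B (deriv (tmul a)) ⟨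
      B *ₛ tmul (deriv (tmul a))                  ≈⟨ *ₛ-congˡ {B} (θ-deriv (tmul a)) ⟨
      B *ₛ θ (tmul a)                             ≈⟨ *ₛ-congʳ B-closed ⟩
      (tmul (b *ₛ A) *ₛ A) *ₛ θ (tmul a)          ≈⟨ *ₛ-assoc (tmul (b *ₛ A)) A (θ (tmul a)) ⟩
      tmul (b *ₛ A) *ₛ (A *ₛ θ (tmul a))          ≈⟨ tmul-*ₛˡ (b *ₛ A) (A *ₛ θ (tmul a)) ⟩
      tmul ((b *ₛ A) *ₛ (A *ₛ θ (tmul a)))        ≈⟨ tmul-cong (*ₛ-assoc b A (A *ₛ θ (tmul a))) ⟩
      tmul (b *ₛ (A *ₛ (A *ₛ θ (tmul a))))        ≈⟨ tmul-cong (*ₛ-congˡ {b} (*ₛ-comm A (A *ₛ θ (tmul a)))) ⟩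
      tmul (b *ₛ ((A *ₛ θ (tmul a)) *ₛ A))        ≈⟨ tmul-cong (*ₛ-congˡ {b} θA-closed) ⟨
      tmul (b *ₛ θ A)                             ≈⟨ tmul-cong (*ₛ-congˡ {b} (θ-deriv A)) ⟩
      tmul (b *ₛ tmul (deriv A))                  ∎

open LinearEquations

<ᵇ-true : ∀ {m n} → m < n → (m <ᵇ n) ≡ true
<ᵇ-true {zero}  (s≤s _)   = refl
<ᵇ-true {suc m} (s≤s m<n) = <ᵇ-true m<n

<ᵇ-false : ∀ {m n} → n ≤ m → (m <ᵇ n) ≡ false
<ᵇ-false {m}     {zero}  _         = refl
<ᵇ-false {suc m} {suc n} (s≤s n≤m) = <ᵇ-false n≤m

+-<ᵇ : ∀ c x y → (c + x <ᵇ c + y) ≡ (x <ᵇ y)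
+-<ᵇ zero    x y = refl
+-<ᵇ (suc c) x y = +-<ᵇ c x y

≤ᵇ-suc : ∀ k c → (suc k ≤ᵇ suc c) ≡ (k ≤ᵇ c)
≤ᵇ-suc zero    c = refl
≤ᵇ-suc (suc k) c = refl

-- `insertAt q x τ` inserts x into τ at position q (at the end if q ≥ length τ);
-- `insertions x τ` of Defs lists exactly these insertions for q = 0 … length τ.
insertAt : ℕ → ℕ → List ℕ → List ℕ
insertAt zero    x ys       = x ∷ ys
insertAt (suc q) x []       = x ∷ []
insertAt (suc q) x (y ∷ ys) = y ∷ insertAt q x ys

-- A crosses B when some entry of A is smaller than some entry of B, i.e. when A
-- does not lie entirely above B.
crosses : List ℕ → List ℕ → Bool
crosses A B = any (λ a → any (a <ᵇ_) B) A

-- Translating every entry by c (standardisation in reverse).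
shift : ℕ → List ℕ → List ℕ
shift c = map (c +_)

module ListFacts where
  open ≡-Reasoning

  any-cong-All : ∀ {A : Set} {P : A → Set} {p q : A → Bool} {xs} →
    All P xs → (∀ x → P x → p x ≡ q x) → any p xs ≡ any q xs
  any-cong-All []         p≡q = refl
  any-cong-All (px ∷ pxs) p≡q = cong₂ _∨_ (p≡q _ px) (any-cong-All pxs p≡q)

  any-++ : ∀ {A : Set} (p : A → Bool) xs ys → any p (xs ++ ys) ≡ any p xs ∨ any p ys
  any-++ p []       ys = refl
  any-++ p (x ∷ xs) ys = trans (cong (p x ∨_) (any-++ p xs ys)) (sym (∨-assoc (p x) (any p xs) (any p ys)))

  any-∧-false : ∀ {A : Set} (p r : A → Bool) xs → any p xs ≡ false → any (λ c → p c ∧ r c) xs ≡ false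
  any-∧-false p r []       _ = refl
  any-∧-false p r (x ∷ xs) e with p x | e
  ... | false | e′ = any-∧-false p r xs e′
  ... | true  | ()

  any-above-bound : ∀ {N} xs → All (_< N) xs → any (N <ᵇ_) xs ≡ false
  any-above-bound []       []           = refl
  any-above-bound (x ∷ xs) (x<N ∷ xs<N) = cong₂ _∨_ (<ᵇ-false (<⇒≤ x<N)) (any-above-bound xs xs<N)

  any-insertAt : ∀ (p : ℕ → Bool) q x τ → any p (insertAt q x τ) ≡ p x ∨ any p τ
  any-insertAt p zero    x τ       = refl
  any-insertAt p (suc q) x []      = refl
  any-insertAt p (suc q) x (y ∷ τ) =
    trans (cong (p y ∨_) (any-insertAt p q x τ)) (∨-left-comm (p y) (p x) (any p τ))

  insertAt-split : ∀ q x τ → insertAt q x τ ≡ take q τ ++ x ∷ drop q τ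
  insertAt-split zero    x τ       = refl
  insertAt-split (suc q) x []      = refl
  insertAt-split (suc q) x (y ∷ τ) = cong (y ∷_) (insertAt-split q x τ)

  map-insertAt : ∀ f q x τ → map f (insertAt q x τ) ≡ insertAt q (f x) (map f τ)
  map-insertAt f zero    x τ       = refl
  map-insertAt f (suc q) x []      = refl
  map-insertAt f (suc q) x (y ∷ τ) = cong (f y ∷_) (map-insertAt f q x τ)

  length-insertAt : ∀ q x τ → length (insertAt q x τ) ≡ suc (length τ)
  length-insertAt zero    x τ       = refl
  length-insertAt (suc q) x []      = refl
  length-insertAt (suc q) x (y ∷ τ) = cong suc (length-insertAt q x τ)

  All-insertAt : ∀ {P : ℕ → Set} q x τ → P x → All P τ → All P (insertAt q x τ)
  All-insertAt zero    x τ       px pτ         = px ∷ pτ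
  All-insertAt (suc q) x []      px pτ         = px ∷ []
  All-insertAt (suc q) x (y ∷ τ) px (py ∷ pτ) = py ∷ All-insertAt q x τ px pτ

  take-insertAt : ∀ p q x τ → q ≤ p → take (suc p) (insertAt q x τ) ≡ insertAt q x (take p τ)
  take-insertAt p       zero    x τ       _         = refl
  take-insertAt (suc p) (suc q) x []      _         = refl
  take-insertAt (suc p) (suc q) x (y ∷ τ) (s≤s q≤p) = cong (y ∷_) (take-insertAt p q x τ q≤p)

  drop-insertAt : ∀ p q x τ → q ≤ p → drop (suc p) (insertAt q x τ) ≡ drop p τ
  drop-insertAt p       zero    x τ       _         = refl
  drop-insertAt (suc p) (suc q) x []      _         = refl
  drop-insertAt (suc p) (suc q) x (y ∷ τ) (s≤s q≤p) = drop-insertAt p q x τ q≤p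

  any-drop-insertAt : ∀ (P : ℕ → Bool) p q x τ → p ≤ q → q ≤ length τ → P x ≡ true →
    any P (drop p (insertAt q x τ)) ≡ true
  any-drop-insertAt P zero    q       x τ       _         _         Px = trans (any-insertAt P q x τ) (cong (_∨ any P τ) Px)
  any-drop-insertAt P (suc p) (suc q) x (y ∷ τ) (s≤s p≤q) (s≤s q≤l) Px = any-drop-insertAt P p q x τ p≤q q≤l Px

  crosses-insertAt : ∀ q N A B → any (N <ᵇ_) B ≡ false → crosses (insertAt q N A) B ≡ crosses A B
  crosses-insertAt q N A B N-top = trans (any-insertAt (λ x → any (x <ᵇ_) B) q N A) (cong (_∨ crosses A B) N-top)

  -- Inserting the maximum N at a position beyond p and cutting after p + 1 entries
  -- puts N into the second part and the first entry of τ, which is below N, into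
  -- the first, so the parts cross.
  late-insertion-crosses : ∀ {N} p q τ → p ≤ q → q < length τ → All (_< N) τ →
    crosses (take (suc p) (insertAt (suc q) N τ)) (drop (suc p) (insertAt (suc q) N τ)) ≡ true
  late-insertion-crosses {N} p q (a ∷ τ) p≤q (s≤s q≤l) (a<N ∷ _) =
    cong (_∨ crosses (take p (insertAt q N τ)) (drop p (insertAt q N τ)))
         (any-drop-insertAt (a <ᵇ_) p q N τ p≤q q≤l (<ᵇ-true a<N))

open ListFacts

larger : ℕ → List ℕ → ℕ
larger a L = length (filter (λ c → T? (a <ᵇ c)) L)

module PatternFacts where
  open ≡-Reasoning

  has21above-insertMax : ∀ {N} a q τ → a < N → All (_< N) τ →
    has21above a (insertAt q N τ) ≡ has21above a τ ∨ any (a <ᵇ_) (drop q τ)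
  has21above-insertMax {N} a zero τ a<N τ<N = begin
    any (λ c → (a <ᵇ c) ∧ (c <ᵇ N)) τ ∨ has21above a τ
      ≡⟨ cong (_∨ has21above a τ) (any-cong-All τ<N below-N) ⟩
    any (a <ᵇ_) τ ∨ has21above a τ
      ≡⟨ ∨-comm (any (a <ᵇ_) τ) (has21above a τ) ⟩
    has21above a τ ∨ any (a <ᵇ_) τ ∎
    where
    below-N : ∀ c → c < N → ((a <ᵇ c) ∧ (c <ᵇ N)) ≡ (a <ᵇ c)
    below-N c c<N = trans (cong ((a <ᵇ c) ∧_) (<ᵇ-true c<N)) (∧-identityʳ (a <ᵇ c))
  has21above-insertMax a (suc q) [] a<N τ<N = refl
  has21above-insertMax {N} a (suc q) (b ∷ τ) a<N (b<N ∷ τ<N) = begin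
    any between (insertAt q N τ) ∨ has21above a (insertAt q N τ)
      ≡⟨ cong₂ _∨_ (any-insertAt between q N τ) (has21above-insertMax a q τ a<N τ<N) ⟩
    ((a <ᵇ N) ∧ (N <ᵇ b) ∨ any between τ) ∨ (has21above a τ ∨ any (a <ᵇ_) (drop q τ))
      ≡⟨ cong (λ z → ((a <ᵇ N) ∧ z ∨ any between τ) ∨ (has21above a τ ∨ any (a <ᵇ_) (drop q τ)))
              (<ᵇ-false (<⇒≤ b<N)) ⟩
    ((a <ᵇ N) ∧ false ∨ any between τ) ∨ (has21above a τ ∨ any (a <ᵇ_) (drop q τ))
      ≡⟨ cong (λ z → (z ∨ any between τ) ∨ (has21above a τ ∨ any (a <ᵇ_) (drop q τ))) (∧-zeroʳ (a <ᵇ N)) ⟩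
    any between τ ∨ (has21above a τ ∨ any (a <ᵇ_) (drop q τ))
      ≡⟨ ∨-assoc (any between τ) (has21above a τ) (any (a <ᵇ_) (drop q τ)) ⟨
    (any between τ ∨ has21above a τ) ∨ any (a <ᵇ_) (drop q τ) ∎
    where
    between : ℕ → Bool
    between c = (a <ᵇ c) ∧ (c <ᵇ b)

  has21above-none : ∀ a B → any (a <ᵇ_) B ≡ false → has21above a B ≡ false
  has21above-none a []      _    = refl
  has21above-none a (b ∷ B) none =
    cong₂ _∨_ (any-∧-false (a <ᵇ_) (_<ᵇ b) B rest) (has21above-none a B rest)
    where
    rest : any (a <ᵇ_) B ≡ false
    rest = ∨-conicalʳ (a <ᵇ b) (any (a <ᵇ_) B) none

  -- α N β contains 132 iff α β does, or α crosses β (then a, N, c with a < c form one).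
  has132-insertMax : ∀ {N} q τ → All (_< N) τ →
    has132 (insertAt q N τ) ≡ has132 τ ∨ crosses (take q τ) (drop q τ)
  has132-insertMax {N} zero τ τ<N = begin
    has21above N τ ∨ has132 τ ≡⟨ cong (_∨ has132 τ) (has21above-none N τ (any-above-bound τ τ<N)) ⟩
    has132 τ                  ≡⟨ ∨-identityʳ (has132 τ) ⟨
    has132 τ ∨ false          ∎
  has132-insertMax (suc q) [] τ<N = refl
  has132-insertMax {N} (suc q) (a ∷ τ) (a<N ∷ τ<N) = begin
    has21above a (insertAt q N τ) ∨ has132 (insertAt q N τ)
      ≡⟨ cong₂ _∨_ (has21above-insertMax a q τ a<N τ<N) (has132-insertMax q τ τ<N) ⟩
    (has21above a τ ∨ any (a <ᵇ_) (drop q τ)) ∨ (has132 τ ∨ crosses (take q τ) (drop q τ))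
      ≡⟨ ∨-interchange (has21above a τ) _ _ _ ⟩
    (has21above a τ ∨ has132 τ) ∨ (any (a <ᵇ_) (drop q τ) ∨ crosses (take q τ) (drop q τ)) ∎

  has21above-++ : ∀ a A B → any (a <ᵇ_) B ≡ false → crosses A B ≡ false →
    has21above a (A ++ B) ≡ has21above a A
  has21above-++ a []      B a-top _      = has21above-none a B a-top
  has21above-++ a (b ∷ A) B a-top A-above = begin
    any between (A ++ B) ∨ has21above a (A ++ B)
      ≡⟨ cong₂ _∨_ (any-++ between A B) (has21above-++ a A B a-top (∨-conicalʳ _ _ A-above)) ⟩
    (any between A ∨ any between B) ∨ has21above a A
      ≡⟨ cong (λ z → (any between A ∨ z) ∨ has21above a A) (any-∧-false (a <ᵇ_) (_<ᵇ b) B a-top) ⟩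
    (any between A ∨ false) ∨ has21above a A
      ≡⟨ cong (_∨ has21above a A) (∨-identityʳ (any between A)) ⟩
    any between A ∨ has21above a A ∎
    where
    between : ℕ → Bool
    between c = (a <ᵇ c) ∧ (c <ᵇ b)

  has132-++ : ∀ A B → crosses A B ≡ false → has132 (A ++ B) ≡ has132 A ∨ has132 B
  has132-++ []      B _       = refl
  has132-++ (a ∷ A) B A-above = begin
    has21above a (A ++ B) ∨ has132 (A ++ B)
      ≡⟨ cong₂ _∨_ (has21above-++ a A B (∨-conicalˡ _ _ A-above) rest) (has132-++ A B rest) ⟩
    has21above a A ∨ (has132 A ∨ has132 B)
      ≡⟨ ∨-assoc (has21above a A) (has132 A) (has132 B) ⟨
    (has21above a A ∨ has132 A) ∨ has132 B ∎
    where
    rest : crosses A B ≡ false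
    rest = ∨-conicalʳ _ _ A-above

  larger-++ : ∀ a A B → larger a (A ++ B) ≡ larger a A + larger a B
  larger-++ a []      B = refl
  larger-++ a (c ∷ A) B with a <ᵇ c
  ... | true  = cong suc (larger-++ a A B)
  ... | false = larger-++ a A B

  larger-none : ∀ a B → any (a <ᵇ_) B ≡ false → larger a B ≡ 0
  larger-none a []      _    = refl
  larger-none a (b ∷ B) none with a <ᵇ b | none
  ... | false | rest = larger-none a B rest
  ... | true  | ()

  larger-above : ∀ {a N} B → a < N → larger a (N ∷ B) ≡ suc (larger a B)
  larger-above B a<N rewrite <ᵇ-true a<N = refl

  -- In α N β with α above β, every entry of α gains exactly the larger later entry
  -- N, the maximum N has none, and the entries of β are unaffected.
  mmp-insertMax : ∀ {N} k A B → All (_< N) A → All (_< N) B → crosses A B ≡ false →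
    mmp (suc k) (A ++ N ∷ B) ≡ mmp k A + mmp (suc k) B
  mmp-insertMax {N} k [] B _ B<N _ rewrite larger-none N B (any-above-bound B B<N) = refl
  mmp-insertMax {N} k (a ∷ A) B (a<N ∷ A<N) B<N A-above = begin
    (if suc k ≤ᵇ larger a (A ++ N ∷ B) then 1 else 0) + mmp (suc k) (A ++ N ∷ B)
      ≡⟨ cong₂ (λ u v → (if suc k ≤ᵇ u then 1 else 0) + v) gains-N (mmp-insertMax k A B A<N B<N rest) ⟩
    (if suc k ≤ᵇ suc (larger a A) then 1 else 0) + (mmp k A + mmp (suc k) B)
      ≡⟨ cong (λ u → (if u then 1 else 0) + (mmp k A + mmp (suc k) B)) (≤ᵇ-suc k (larger a A)) ⟩
    (if k ≤ᵇ larger a A then 1 else 0) + (mmp k A + mmp (suc k) B)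
      ≡⟨ +-assoc (if k ≤ᵇ larger a A then 1 else 0) (mmp k A) (mmp (suc k) B) ⟨
    (if k ≤ᵇ larger a A then 1 else 0) + mmp k A + mmp (suc k) B ∎
    where
    rest : crosses A B ≡ false
    rest = ∨-conicalʳ _ _ A-above

    gains-N : larger a (A ++ N ∷ B) ≡ suc (larger a A)
    gains-N = begin
      larger a (A ++ N ∷ B)          ≡⟨ larger-++ a A (N ∷ B) ⟩
      larger a A + larger a (N ∷ B)  ≡⟨ cong (larger a A +_) (larger-above B a<N) ⟩
      larger a A + suc (larger a B)  ≡⟨ cong (λ m → larger a A + suc m) (larger-none a B (∨-conicalˡ _ _ A-above)) ⟩
      larger a A + 1                 ≡⟨ +-comm (larger a A) 1 ⟩
      suc (larger a A)               ∎

  -- Translation preserves all comparisons, hence has132 and mmp.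
  any-shift : ∀ (p : ℕ → Bool) c L → any p (shift c L) ≡ any (λ x → p (c + x)) L
  any-shift p c []      = refl
  any-shift p c (x ∷ L) = cong (p (c + x) ∨_) (any-shift p c L)

  larger-shift : ∀ c a L → larger (c + a) (shift c L) ≡ larger a L
  larger-shift c a []      = refl
  larger-shift c a (x ∷ L) rewrite +-<ᵇ c a x with a <ᵇ x
  ... | true  = cong suc (larger-shift c a L)
  ... | false = larger-shift c a L

  has21above-shift : ∀ c a L → has21above (c + a) (shift c L) ≡ has21above a L
  has21above-shift c a []      = refl
  has21above-shift c a (b ∷ L) = cong₂ _∨_ between-shift (has21above-shift c a L)
    where
    between-shift : any (λ x → (c + a <ᵇ x) ∧ (x <ᵇ c + b)) (shift c L) ≡ any (λ x → (a <ᵇ x) ∧ (x <ᵇ b)) L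
    between-shift = trans (any-shift (λ x → (c + a <ᵇ x) ∧ (x <ᵇ c + b)) c L)
                          (cong or (map-cong (λ x → cong₂ _∧_ (+-<ᵇ c a x) (+-<ᵇ c x b)) L))

  has132-shift : ∀ c L → has132 (shift c L) ≡ has132 L
  has132-shift c []      = refl
  has132-shift c (a ∷ L) = cong₂ _∨_ (has21above-shift c a L) (has132-shift c L)

  mmp-shift : ∀ m c L → mmp m (shift c L) ≡ mmp m L
  mmp-shift m c []      = refl
  mmp-shift m c (a ∷ L) =
    cong₂ (λ u v → (if m ≤ᵇ u then 1 else 0) + v) (larger-shift c a L) (mmp-shift m c L)

open PatternFacts

ind : Bool → ℕ
ind true  = 1
ind false = 0

∑∈ : List (List ℕ) → (List ℕ → ℕ) → ℕ
∑∈ L f = sum (map f L)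

syntax ∑∈ L (λ σ → e) = ∑[ σ ∈ L ] e

Shape : ℕ → List ℕ → Set
Shape n τ = length τ ≡ n × All (_< suc n) τ

splitWeight : (List ℕ → List ℕ → ℕ) → ℕ → List ℕ → ℕ
splitWeight F p τ = ind (not (crosses (take p τ) (drop p τ))) * F (take p τ) (drop p τ)

module PermutationSums where
  open ≡-Reasoning

  count-filter : ∀ (p : List ℕ → Bool) L → length (filter (λ σ → T? (p σ)) L) ≡ ∑[ σ ∈ L ] ind (p σ)
  count-filter p []      = refl
  count-filter p (σ ∷ L) with p σ
  ... | true  = cong suc (count-filter p L)
  ... | false = count-filter p L

  ∑∈-cong : ∀ L {f g} → f ≗ g → ∑∈ L f ≡ ∑∈ L g
  ∑∈-cong L f≗g = cong sum (map-cong f≗g L)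

  ∑∈-cong-All : ∀ {P : List ℕ → Set} {L f g} → All P L → (∀ σ → P σ → f σ ≡ g σ) → ∑∈ L f ≡ ∑∈ L g
  ∑∈-cong-All []         f≡g = refl
  ∑∈-cong-All (pσ ∷ pL) f≡g = cong₂ _+_ (f≡g _ pσ) (∑∈-cong-All pL f≡g)

  ∑∈-++ : ∀ A B f → ∑∈ (A ++ B) f ≡ ∑∈ A f + ∑∈ B f
  ∑∈-++ A B f = trans (cong sum (map-++ f A B)) (sum-++ (map f A) (map f B))

  ∑∈-concatMap : ∀ (g : List ℕ → List (List ℕ)) L f → ∑∈ (concatMap g L) f ≡ ∑[ σ ∈ L ] ∑∈ (g σ) f
  ∑∈-concatMap g []      f = refl
  ∑∈-concatMap g (σ ∷ L) f = trans (∑∈-++ (g σ) (concatMap g L) f) (cong (∑∈ (g σ) f +_) (∑∈-concatMap g L f))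

  ∑∈-insertions : ∀ x τ f → ∑∈ (insertions x τ) f ≡ ∑[ q < suc (length τ) ] f (insertAt q x τ)
  ∑∈-insertions x []      f = refl
  ∑∈-insertions x (y ∷ τ) f = cong (f (x ∷ y ∷ τ) +_) (begin
    ∑∈ (map (y ∷_) (insertions x τ)) f             ≡⟨ cong sum (map-∘ (insertions x τ)) ⟨
    ∑[ σ ∈ insertions x τ ] f (y ∷ σ)              ≡⟨ ∑∈-insertions x τ (λ σ → f (y ∷ σ)) ⟩
    ∑[ q < suc (length τ) ] f (y ∷ insertAt q x τ) ∎)

  ∑∈-∑ : ∀ L k (f : List ℕ → ℕ → ℕ) → ∑[ σ ∈ L ] ∑[ q < k ] f σ q ≡ ∑[ q < k ] ∑[ σ ∈ L ] f σ q
  ∑∈-∑ []      k f = sym (∑-zero k)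
  ∑∈-∑ (σ ∷ L) k f = trans (cong (∑< k (f σ) +_) (∑∈-∑ L k f))
                           (sym (∑-+ k (f σ) (λ q → ∑[ τ ∈ L ] f τ q)))

  ∑∈-+ : ∀ L f g → ∑[ σ ∈ L ] (f σ + g σ) ≡ ∑∈ L f + ∑∈ L g
  ∑∈-+ []      f g = refl
  ∑∈-+ (σ ∷ L) f g = trans (cong (f σ + g σ +_) (∑∈-+ L f g)) (interchange (f σ) (g σ) (∑∈ L f) (∑∈ L g))

  ∑∈-*ˡ : ∀ L c f → ∑[ σ ∈ L ] (c * f σ) ≡ c * ∑∈ L f
  ∑∈-*ˡ []      c f = sym (*-zeroʳ c)
  ∑∈-*ˡ (σ ∷ L) c f = trans (cong (c * f σ +_) (∑∈-*ˡ L c f)) (sym (*-distribˡ-+ c (f σ) _))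

  ∑∈-product : ∀ A B f g → ∑[ α ∈ A ] ∑[ β ∈ B ] (f α * g β) ≡ ∑∈ A f * ∑∈ B g
  ∑∈-product A B f g = begin
    ∑[ α ∈ A ] ∑[ β ∈ B ] (f α * g β) ≡⟨ ∑∈-cong A (λ α → ∑∈-*ˡ B (f α) g) ⟩
    ∑[ α ∈ A ] (f α * ∑∈ B g)          ≡⟨ ∑∈-cong A (λ α → *-comm (f α) (∑∈ B g)) ⟩
    ∑[ α ∈ A ] (∑∈ B g * f α)          ≡⟨ ∑∈-*ˡ A (∑∈ B g) f ⟩
    ∑∈ B g * ∑∈ A f                    ≡⟨ *-comm (∑∈ B g) (∑∈ A f) ⟩
    ∑∈ A f * ∑∈ B g                    ∎

  All-insertions : ∀ {P : List ℕ → Set} x τ → (∀ q → P (insertAt q x τ)) → All P (insertions x τ)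
  All-insertions         x []      P-ins = P-ins 0 ∷ []
  All-insertions {P = P} x (y ∷ τ) P-ins =
    P-ins 0 ∷ map⁺ (All-insertions {P = λ σ → P (y ∷ σ)} x τ (λ q → P-ins (suc q)))

  perms-shape : ∀ n → All (Shape n) (perms n)
  perms-shape zero    = (refl , []) ∷ []
  perms-shape (suc n) = concat⁺ (map⁺ (All.map insertions-shape (perms-shape n)))
    where
    insertions-shape : ∀ {τ} → Shape n τ → All (Shape (suc n)) (insertions (suc n) τ)
    insertions-shape {τ} (len , τ<) = All-insertions (suc n) τ (λ q →
      trans (length-insertAt q (suc n) τ) (cong suc len) ,
      All-insertAt q (suc n) τ ≤-refl (All.map m<n⇒m<1+n τ<))

  ∑-perms-suc : ∀ n f → ∑∈ (perms (suc n)) f ≡ ∑[ τ ∈ perms n ] ∑[ q < suc n ] f (insertAt q (suc n) τ)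
  ∑-perms-suc n f = trans (∑∈-concatMap (insertions (suc n)) (perms n) f)
    (∑∈-cong-All (perms-shape n) (λ τ (len , _) →
      trans (∑∈-insertions (suc n) τ f) (cong (λ m → ∑[ q < suc m ] f (insertAt q (suc n) τ)) len)))

open PermutationSums

module Splittings where
  open ≡-Reasoning

  -- Summing over the positions of the maximum N = n + 1 inserted into τ ∈ S_n and
  -- cutting after p + 1 entries: positions beyond p put N into the second part,
  -- which then crosses the first; the others insert N into the first part without
  -- changing whether it lies above the second.
  splitWeight-insertMax : ∀ {n} F p τ → p ≤ n → Shape n τ →
    ∑[ q < suc n ] splitWeight F (suc p) (insertAt q (suc n) τ)
      ≡ splitWeight (λ A B → ∑[ q < suc p ] F (insertAt q (suc n) A) B) p τ
  splitWeight-insertMax {n} F p τ p≤n (len , τ<N) = begin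
    ∑[ q < suc n ] splitWeight F (suc p) (insertAt q (suc n) τ)
      ≡⟨ ∑-truncate (suc n) (suc p) (λ q → splitWeight F (suc p) (insertAt q (suc n) τ)) (s≤s p≤n) late ⟩
    ∑[ q < suc p ] splitWeight F (suc p) (insertAt q (suc n) τ)
      ≡⟨ ∑-cong< (suc p) early ⟩
    ∑[ q < suc p ] (above * F (insertAt q (suc n) (take p τ)) (drop p τ))
      ≡⟨ ∑-*ˡ (suc p) above (λ q → F (insertAt q (suc n) (take p τ)) (drop p τ)) ⟩
    above * ∑[ q < suc p ] F (insertAt q (suc n) (take p τ)) (drop p τ) ∎
    where
    above : ℕ
    above = ind (not (crosses (take p τ) (drop p τ)))

    late : ∀ q → suc p ≤ q → q < suc n → splitWeight F (suc p) (insertAt q (suc n) τ) ≡ 0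
    late (suc q) (s≤s p≤q) (s≤s q<n)
      rewrite late-insertion-crosses p q τ p≤q (subst (q <_) (sym len) q<n) τ<N = refl

    early : ∀ q → q < suc p →
      splitWeight F (suc p) (insertAt q (suc n) τ) ≡ above * F (insertAt q (suc n) (take p τ)) (drop p τ)
    early q (s≤s q≤p)
      rewrite take-insertAt p q (suc n) τ q≤p | drop-insertAt p q (suc n) τ q≤p
            | crosses-insertAt q (suc n) (take p τ) (drop p τ) (any-above-bound (drop p τ) (drop⁺ p τ<N))
      = refl

  -- Translation commutes with inserting the maximum: inserting c + p + 1 into
  -- shift c α for α ∈ S_p runs over shift c α′ for α′ ∈ S_{p+1}.
  perms-suc-shifted : ∀ c p (F : List ℕ → List ℕ → ℕ) →
    ∑[ α ∈ perms (suc p) ] ∑[ β ∈ perms c ] F (shift c α) β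
      ≡ ∑[ α ∈ perms p ] ∑[ β ∈ perms c ] ∑[ q < suc p ] F (insertAt q (c + suc p) (shift c α)) β
  perms-suc-shifted c p F = begin
    ∑[ α ∈ perms (suc p) ] ∑[ β ∈ perms c ] F (shift c α) β
      ≡⟨ ∑-perms-suc p (λ α → ∑[ β ∈ perms c ] F (shift c α) β) ⟩
    ∑[ α ∈ perms p ] ∑[ q < suc p ] ∑[ β ∈ perms c ] F (shift c (insertAt q (suc p) α)) β
      ≡⟨ ∑∈-cong (perms p) (λ α → ∑∈-∑ (perms c) (suc p) (λ β q → F (shift c (insertAt q (suc p) α)) β)) ⟨
    ∑[ α ∈ perms p ] ∑[ β ∈ perms c ] ∑[ q < suc p ] F (shift c (insertAt q (suc p) α)) β
      ≡⟨ ∑∈-cong (perms p) (λ α → ∑∈-cong (perms c) (λ β → ∑-cong (suc p) (λ q →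
           cong (λ σ → F σ β) (map-insertAt (c +_) q (suc p) α)))) ⟩
    ∑[ α ∈ perms p ] ∑[ β ∈ perms c ] ∑[ q < suc p ] F (insertAt q (c + suc p) (shift c α)) β ∎

  -- Permutations τ of [n] whose first p entries lie above the others correspond to
  -- pairs (α, β) ∈ S_p × S_{n-p} via τ = shift (n ∸ p) α ++ β.
  split-count : ∀ n p → p ≤ n → (F : List ℕ → List ℕ → ℕ) →
    ∑[ τ ∈ perms n ] splitWeight F p τ ≡ ∑[ α ∈ perms p ] ∑[ β ∈ perms (n ∸ p) ] F (shift (n ∸ p) α) β
  split-count n       zero    _         F =
    trans (∑∈-cong (perms n) (λ τ → +-identityʳ (F [] τ))) (sym (+-identityʳ _))
  split-count zero    (suc p) ()        F
  split-count (suc n) (suc p) (s≤s p≤n) F = begin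
    ∑[ τ ∈ perms (suc n) ] splitWeight F (suc p) τ
      ≡⟨ ∑-perms-suc n (splitWeight F (suc p)) ⟩
    ∑[ τ ∈ perms n ] ∑[ q < suc n ] splitWeight F (suc p) (insertAt q (suc n) τ)
      ≡⟨ ∑∈-cong-All (perms-shape n) (λ τ → splitWeight-insertMax F p τ p≤n) ⟩
    ∑[ τ ∈ perms n ] splitWeight G p τ
      ≡⟨ split-count n p p≤n G ⟩
    insertingMax (suc n)
      ≡⟨ cong insertingMax size ⟨
    insertingMax (n ∸ p + suc p)
      ≡⟨ perms-suc-shifted (n ∸ p) p F ⟨
    ∑[ α ∈ perms (suc p) ] ∑[ β ∈ perms (n ∸ p) ] F (shift (n ∸ p) α) β ∎
    where
    G : List ℕ → List ℕ → ℕ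
    G A B = ∑[ q < suc p ] F (insertAt q (suc n) A) B

    insertingMax : ℕ → ℕ
    insertingMax N = ∑[ α ∈ perms p ] ∑[ β ∈ perms (n ∸ p) ] ∑[ q < suc p ] F (insertAt q N (shift (n ∸ p) α)) β

    size : n ∸ p + suc p ≡ suc n
    size = trans (+-suc (n ∸ p) p) (cong suc (m∸n+n≡m p≤n))

open Splittings

avoids : ℕ → ℕ → List ℕ → ℕ
avoids m j σ = ind (not (has132 σ) ∧ (mmp m σ ≡ᵇ j))

pairWeight : ℕ → ℕ → List ℕ → List ℕ → ℕ
pairWeight k j α β = ind (not (has132 α ∨ has132 β) ∧ (mmp k α + mmp (suc k) β ≡ᵇ j))

module Decomposition where
  open ≡-Reasoning

  Qcoef-∑ : ∀ m n j → Qcoef m n j ≡ ∑[ σ ∈ perms n ] avoids m j σ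
  Qcoef-∑ m n j = count-filter (λ σ → not (has132 σ) ∧ (mmp m σ ≡ᵇ j)) (perms n)

  avoids-insertMax : ∀ {N} k j q τ → All (_< N) τ →
    avoids (suc k) j (insertAt q N τ) ≡ splitWeight (pairWeight k j) q τ
  avoids-insertMax {N} k j q τ τ<N rewrite has132-insertMax q τ τ<N with crosses (take q τ) (drop q τ) in A-B
  ... | true  rewrite ∨-zeroʳ (has132 τ) = refl
  ... | false = begin
    ind (not (has132 τ ∨ false) ∧ (mmp (suc k) (insertAt q N τ) ≡ᵇ j))
      ≡⟨ cong₂ (λ h m → ind (not h ∧ (m ≡ᵇ j))) parts-132 parts-mmp ⟩
    pairWeight k j A B
      ≡⟨ *-identityˡ (pairWeight k j A B) ⟨
    1 * pairWeight k j A B ∎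
    where
    A B : List ℕ
    A = take q τ
    B = drop q τ

    parts-132 : has132 τ ∨ false ≡ has132 A ∨ has132 B
    parts-132 = trans (∨-identityʳ (has132 τ)) (trans (cong has132 (sym (take++drop≡id q τ))) (has132-++ A B A-B))

    parts-mmp : mmp (suc k) (insertAt q N τ) ≡ mmp k A + mmp (suc k) B
    parts-mmp = trans (cong (mmp (suc k)) (insertAt-split q N τ)) (mmp-insertMax k A B (take⁺ q τ<N) (drop⁺ q τ<N) A-B)

  pairWeight-shift : ∀ k j c α β → pairWeight k j (shift c α) β ≡ pairWeight k j α β
  pairWeight-shift k j c α β rewrite has132-shift c α | mmp-shift k c α = refl

  ind-+-split : ∀ a b j → ind (a + b ≡ᵇ j) ≡ ∑[ i < suc j ] (ind (a ≡ᵇ i) * ind (b ≡ᵇ j ∸ i))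
  ind-+-split zero    b j       = begin
    ind (b ≡ᵇ j)                    ≡⟨ +-identityʳ _ ⟨
    ind (b ≡ᵇ j) + 0                ≡⟨ cong₂ _+_ (+-identityʳ (ind (b ≡ᵇ j))) (∑-zero j) ⟨
    ind (b ≡ᵇ j) + 0 + ∑[ i < j ] 0 ∎
  ind-+-split (suc a) b zero    = refl
  ind-+-split (suc a) b (suc j) = ind-+-split a b j

  avoid-split : ∀ x y a b j → ind (not (x ∨ y) ∧ (a + b ≡ᵇ j))
    ≡ ∑[ i < suc j ] (ind (not x ∧ (a ≡ᵇ i)) * ind (not y ∧ (b ≡ᵇ j ∸ i)))
  avoid-split true  y    a b j = sym (∑-zero (suc j))
  avoid-split false true a b j = sym (trans (∑-cong (suc j) (λ i → *-zeroʳ (ind (a ≡ᵇ i)))) (∑-zero (suc j)))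
  avoid-split false false a b j = ind-+-split a b j

  -- The functional equation Q^(k+1)(t,x) = 1 + t Q^(k)(t,x) Q^(k+1)(t,x), coefficientwise.
  Qcoef-suc : ∀ k n j →
    Qcoef (suc k) (suc n) j ≡ ∑[ q < suc n ] ∑[ i < suc j ] (Qcoef k q i * Qcoef (suc k) (n ∸ q) (j ∸ i))
  Qcoef-suc k n j = begin
    Qcoef (suc k) (suc n) j
      ≡⟨ Qcoef-∑ (suc k) (suc n) j ⟩
    ∑[ σ ∈ perms (suc n) ] avoids (suc k) j σ
      ≡⟨ ∑-perms-suc n (avoids (suc k) j) ⟩
    ∑[ τ ∈ perms n ] ∑[ q < suc n ] avoids (suc k) j (insertAt q (suc n) τ)
      ≡⟨ ∑∈-cong-All (perms-shape n) (λ τ (_ , τ<) → ∑-cong (suc n) (λ q → avoids-insertMax k j q τ τ<)) ⟩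
    ∑[ τ ∈ perms n ] ∑[ q < suc n ] splitWeight (pairWeight k j) q τ
      ≡⟨ ∑∈-∑ (perms n) (suc n) (λ τ q → splitWeight (pairWeight k j) q τ) ⟩
    ∑[ q < suc n ] ∑[ τ ∈ perms n ] splitWeight (pairWeight k j) q τ
      ≡⟨ ∑-cong< (suc n) (λ q q<1+n → split-count n q (≤-pred q<1+n) (pairWeight k j)) ⟩
    ∑[ q < suc n ] ∑[ α ∈ perms q ] ∑[ β ∈ perms (n ∸ q) ] pairWeight k j (shift (n ∸ q) α) β
      ≡⟨ ∑-cong (suc n) pairs ⟩
    ∑[ q < suc n ] ∑[ i < suc j ] (Qcoef k q i * Qcoef (suc k) (n ∸ q) (j ∸ i)) ∎
    where
    pairs : ∀ q → ∑[ α ∈ perms q ] ∑[ β ∈ perms (n ∸ q) ] pairWeight k j (shift (n ∸ q) α) β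
                ≡ ∑[ i < suc j ] (Qcoef k q i * Qcoef (suc k) (n ∸ q) (j ∸ i))
    pairs q = begin
      ∑[ α ∈ perms q ] ∑[ β ∈ perms c ] pairWeight k j (shift c α) β
        ≡⟨ ∑∈-cong (perms q) (λ α → ∑∈-cong (perms c) (λ β →
             trans (pairWeight-shift k j c α β) (avoid-split (has132 α) (has132 β) (mmp k α) (mmp (suc k) β) j))) ⟩
      ∑[ α ∈ perms q ] ∑[ β ∈ perms c ] ∑[ i < suc j ] (avoids k i α * avoids (suc k) (j ∸ i) β)
        ≡⟨ ∑∈-cong (perms q) (λ α → ∑∈-∑ (perms c) (suc j) (λ β i → avoids k i α * avoids (suc k) (j ∸ i) β)) ⟩
      ∑[ α ∈ perms q ] ∑[ i < suc j ] ∑[ β ∈ perms c ] (avoids k i α * avoids (suc k) (j ∸ i) β)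
        ≡⟨ ∑∈-∑ (perms q) (suc j) (λ α i → ∑[ β ∈ perms c ] (avoids k i α * avoids (suc k) (j ∸ i) β)) ⟩
      ∑[ i < suc j ] ∑[ α ∈ perms q ] ∑[ β ∈ perms c ] (avoids k i α * avoids (suc k) (j ∸ i) β)
        ≡⟨ ∑-cong (suc j) (λ i → ∑∈-product (perms q) (perms c) (avoids k i) (avoids (suc k) (j ∸ i))) ⟩
      ∑[ i < suc j ] (∑∈ (perms q) (avoids k i) * ∑∈ (perms c) (avoids (suc k) (j ∸ i)))
        ≡⟨ ∑-cong (suc j) (λ i → cong₂ _*_ (Qcoef-∑ k q i) (Qcoef-∑ (suc k) c (j ∸ i))) ⟨
      ∑[ i < suc j ] (Qcoef k q i * Qcoef (suc k) c (j ∸ i)) ∎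
      where
      c : ℕ
      c = n ∸ q

  Q0-recurrence : ∀ k → Q0 (suc k) ≗ one +ₛ tmul (Q0 k *ₛ Q0 (suc k))
  Q0-recurrence k zero    = refl
  Q0-recurrence k (suc n) = begin
    Qcoef (suc k) (suc n) 0                           ≡⟨ Qcoef-suc k n 0 ⟩
    ∑[ q < suc n ] (Q0 k q * Q0 (suc k) (n ∸ q) + 0)
      ≡⟨ ∑-cong (suc n) (λ q → +-identityʳ (Q0 k q * Q0 (suc k) (n ∸ q))) ⟩
    ∑[ q < suc n ] (Q0 k q * Q0 (suc k) (n ∸ q))
      ≡⟨ *ₛ-coeff (Q0 k) (Q0 (suc k)) n ⟨
    (Q0 k *ₛ Q0 (suc k)) n ∎

  Qx-recurrence : ∀ k → Qx (suc k) ≗ tmul (Qx k *ₛ Q0 (suc k) +ₛ Q0 k *ₛ Qx (suc k))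
  Qx-recurrence k zero    = refl
  Qx-recurrence k (suc n) = begin
    Qcoef (suc k) (suc n) 1
      ≡⟨ Qcoef-suc k n 1 ⟩
    ∑[ q < suc n ] (Q0 k q * Qx (suc k) (n ∸ q) + (Qx k q * Q0 (suc k) (n ∸ q) + 0))
      ≡⟨ ∑-cong (suc n) reorder ⟩
    ∑[ q < suc n ] (Qx k q * Q0 (suc k) (n ∸ q) + Q0 k q * Qx (suc k) (n ∸ q))
      ≡⟨ ∑-+ (suc n) (λ q → Qx k q * Q0 (suc k) (n ∸ q)) (λ q → Q0 k q * Qx (suc k) (n ∸ q)) ⟩
    ∑[ q < suc n ] (Qx k q * Q0 (suc k) (n ∸ q)) + ∑[ q < suc n ] (Q0 k q * Qx (suc k) (n ∸ q))
      ≡⟨ cong₂ _+_ (*ₛ-coeff (Qx k) (Q0 (suc k)) n) (*ₛ-coeff (Q0 k) (Qx (suc k)) n) ⟨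
    (Qx k *ₛ Q0 (suc k)) n + (Q0 k *ₛ Qx (suc k)) n ∎
    where
    reorder : ∀ q → Q0 k q * Qx (suc k) (n ∸ q) + (Qx k q * Q0 (suc k) (n ∸ q) + 0)
                  ≡ Qx k q * Q0 (suc k) (n ∸ q) + Q0 k q * Qx (suc k) (n ∸ q)
    reorder q = trans (cong (Q0 k q * Qx (suc k) (n ∸ q) +_) (+-identityʳ (Qx k q * Q0 (suc k) (n ∸ q))))
                      (+-comm (Q0 k q * Qx (suc k) (n ∸ q)) (Qx k q * Q0 (suc k) (n ∸ q)))

open Decomposition

theorem10 : (k : ℕ) → (n : ℕ) →
    (Qx (suc k) *ₛ deriv (tmul (Q0 k))) n ≡ (Qx k *ₛ tmul (deriv (Q0 (suc k)))) n
theorem10 k = derivative-identity {Q0 k} {Qx k} {Q0 (suc k)} {Qx (suc k)} (Q0-recurrence k) (Qx-recurrence k)
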